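{- Let $a\ge 1$ be an integer, let $k=2a$, and let $G=(\mathbb{Z}_{k^2+1},+)$. (i) Let $B_1=\{0,1,\ldots,a-1\}\cup\{2a,2a+1,\ldots,3a-1\}$ and $B_2=\bigcup_{i=1}^{a}\{(4i-1)a,\,4ia\}$. Then $\{B_1,B_2\}$ is a $(k^2+1,2,k,1)$-SEDF in $G$. (ii) For $k>2$, the SEDF $\{B_1,B_2\}$ is not equivalent to the $(k^2+1,2,k,1)$-SEDF $\{A_1,A_2\}$ in $\mathbb{Z}_{k^2+1}$ with $A_1=\{0,1,\ldots,k-1\}$ and $A_2=\{k,2k,\ldots,k^2\}$.
   Context: For an additive group $G$ of order $n$, an $(n,m,k,\lambda)$-SEDF is a set of $m\ge2$ pairwise disjoint $k$-subsets $A_1,\ldots,A_m$ of $G$ such that for every $i$ the multiset $\{x-y: x\in A_i, y\in \bigcup_{j\neq i}A_j\}$ contains every non-zero element of $G$ exactly $\lambda$ times. Two $(n,m,k,\lambda)$-SEDFs $\{A_1,\ldots,A_m\}$ and $\{A'_1,\ldots,A'_m\}$ over the same group $G$ are equivalent if there exist an automorphism $\alpha$ of $G$ and elements $g,h\in G$ such that (after suitable ordering of the sets) $A'_i=h\,\alpha(A_i)\,g$ for all $i$; for $G=\mathbb{Z}_n$ this means there are a unit $u$ of $\mathbb{Z}_n$ and $c\in\mathbb{Z}_n$ with $\{A'_1,\ldots,A'_m\}=\{uA_1+c,\ldots,uA_m+c\}$. Elements of $\mathbb{Z}_n$ are $\{0,1,\ldots,n-1\}$. -}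

module Defs where

open import Data.Nat using (ℕ; zero; suc; _+_; _*_; _∸_; _<_; _≤_; NonZero; _≟_)
open import Data.Nat.DivMod using (_%_)
open import Data.Fin using (Fin; zero; suc)
open import Data.Fin.Permutation using (Permutation′; _⟨$⟩ʳ_)
open import Data.List using (List; []; _∷_; _++_; map; concatMap; length; upTo; filter; allFin)
open import Data.List.Membership.Propositional using (_∈_)
open import Data.List.Relation.Unary.All using (All)
open import Data.List.Relation.Unary.Unique.Propositional using (Unique)
open import Data.List.Relation.Binary.Disjoint.Propositional using (Disjoint)
open import Data.Product using (Σ; _×_; ∃)
open import Function.Bundles using (_⇔_)
open import Relation.Binary.PropositionalEquality using (_≡_; _≢_)
open import Relation.Nullary using (¬_; Dec)
import Data.Fin as F

-- Elements of ℤ_n are represented as natural numbers 0,…,n-1.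
-- Difference x - y in ℤ_n.
diffZ : (n : ℕ) → .{{_ : NonZero n}} → ℕ → ℕ → ℕ
diffZ n x y = (x + (n ∸ (y % n))) % n

othersIdx : {m : ℕ} → Fin m → List (Fin m)
othersIdx {m} i = filter (λ j → ¬? (j F.≟ i)) (allFin m)
  where open import Relation.Nullary using (¬?)

diffMultiset : (n : ℕ) → .{{_ : NonZero n}} → {m : ℕ} → (Fin m → List ℕ) → Fin m → List ℕ
diffMultiset n A i =
  concatMap (λ x → concatMap (λ j → map (λ y → diffZ n x y) (A j)) (othersIdx i)) (A i)

IsSEDF : (n : ℕ) → .{{_ : NonZero n}} → (m k lam : ℕ) → (Fin m → List ℕ) → Set
IsSEDF n m k lam A =
  (2 ≤ m)
  × (∀ i → Unique (A i) × length (A i) ≡ k × All (_< n) (A i))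
  × (∀ i j → i ≢ j → Disjoint (A i) (A j))
  × (∀ i g → 0 < g → g < n → length (filter (_≟ g) (diffMultiset n A i)) ≡ lam)

SameSet : List ℕ → List ℕ → Set
SameSet X Y = ∀ x → (x ∈ X) ⇔ (x ∈ Y)

IsUnit : (n : ℕ) → .{{_ : NonZero n}} → ℕ → Set
IsUnit n u = ∃ λ v → (u * v) % n ≡ 1 % n

-- Equivalence of families over ℤ_n:
-- {A'_1..A'_m} = {uA_1+c, …, uA_m+c} for a unit u and c ∈ ℤ_n.
Equivalent : (n : ℕ) → .{{_ : NonZero n}} → (m : ℕ) → (Fin m → List ℕ) → (Fin m → List ℕ) → Set
Equivalent n m A A' =
  Σ ℕ λ u → Σ ℕ λ c → u < n × c < n × IsUnit n u ×
  Σ (Permutation′ m) λ σ →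
    ∀ i → SameSet (A' (σ ⟨$⟩ʳ i)) (map (λ x → (u * x + c) % n) (A i))

pair : List ℕ → List ℕ → Fin 2 → List ℕ
pair X Y zero = X
pair X Y (suc _) = Y

B1 : ℕ → List ℕ
B1 a = upTo a ++ map (λ t → 2 * a + t) (upTo a)

-- B_2 = ⋃_{i=1}^{a} {(4i-1)a, 4ia}; with i = t+1: (4t+3)a and (4t+4)a
B2 : ℕ → List ℕ
B2 a = concatMap (λ t → (4 * t + 3) * a ∷ (4 * t + 4) * a ∷ []) (upTo a)

A1 : ℕ → List ℕ
A1 k = upTo k

A2 : ℕ → List ℕ
A2 k = map (λ t → (suc t) * k) (upTo k)

-- (i) For y in the t-th pair {(4t+3)a, (4t+4)a} of B2 and x ∈ B1, the difference y − x is j·a − s with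
-- s < a and j ∈ {4t+1, …, 4t+4}; so j runs once over [1, 4a] and, by division with remainder of g − 1 by a,
-- every g ∈ [1, 4a²] is hit exactly once. All of B1 lies below all of B2, so B1 − B2 = −(B2 − B1) is
-- covered once as well.
-- (ii) An affine map f x = u x + c satisfies k f(1) + f(0) ≡ f(k) + k f(0). If f sends 0, 1, k ∈ B1 into
-- A1 = [0, k), both sides are two-digit base-k numerals below n, hence equal, and f(1) = f(0). Since
-- A2 = k·A1 + k and k is a unit (k² ≡ −1), the case A2 reduces to the same digit comparison. Either way
-- u ≡ 0, which is not a unit.
module Submission where

open import Defs
open import Data.Bool using (true; false; if_then_else_)
open import Data.Nat
open import Data.Fin using (zero; suc)
open import Data.Nat.Properties
open import Data.Nat.DivMod
open import Data.Nat.ListAction using (sum)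
open import Data.Nat.ListAction.Properties using (sum-↭)
open import Data.Nat.Tactic.RingSolver using (solve-∀)
open import Data.Product using (_×_; _,_; proj₁; proj₂; ∃)
open import Data.List using (List; []; _∷_; _++_; map; concatMap; upTo; downFrom; applyUpTo; reverse; length; filter)
open import Data.List.Properties using (++-identityʳ; map-upTo; reverse-upTo; length-++; length-map; length-upTo)
open import Data.List.Membership.Propositional using (_∈_)
open import Data.List.Membership.Propositional.Properties using (∈-upTo⁻; ∈-upTo⁺; ∈-map⁻; ∈-map⁺; ∈-++⁺ˡ; ∈-++⁺ʳ)
open import Data.List.Relation.Unary.Any using (here; there)
open import Data.List.Relation.Binary.Permutation.Propositional using (_↭_)
import Data.List.Relation.Binary.Permutation.Propositional.Properties as ↭
open import Data.List.Relation.Unary.All as All using (All; []; _∷_)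
import Data.List.Relation.Unary.All.Properties as All
import Data.List.Relation.Unary.AllPairs.Properties as AllPairs
open import Data.List.Relation.Unary.Unique.Propositional using (Unique; []; _∷_)
import Data.List.Relation.Unary.Unique.Propositional.Properties as Unique
open import Data.List.Relation.Binary.Disjoint.Propositional using (Disjoint)
open import Data.Empty using (⊥-elim)
open import Data.Fin.Permutation using (_⟨$⟩ʳ_)
open import Function using (_∘_; id)
open import Function.Bundles using (Equivalence)
open import Relation.Binary.PropositionalEquality
open import Relation.Nullary using (¬_; does; yes; no)
open import Relation.Nullary.Decidable using (dec-true; dec-false)
open ≡-Reasoning

∑ : {A : Set} → List A → (A → ℕ) → ℕ
∑ xs f = sum (map f xs)

syntax ∑ xs (λ x → e) = ∑[ x ∈ xs ] e

private variable
  A B : Set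

∑-++ : ∀ (xs ys : List A) f → ∑ (xs ++ ys) f ≡ ∑ xs f + ∑ ys f
∑-++ []       ys f = refl
∑-++ (x ∷ xs) ys f = trans (cong (f x +_) (∑-++ xs ys f)) (sym (+-assoc (f x) _ _))

∑-map : ∀ (h : A → B) xs f → ∑ (map h xs) f ≡ ∑ xs (f ∘ h)
∑-map h []       f = refl
∑-map h (x ∷ xs) f = cong (f (h x) +_) (∑-map h xs f)

∑-concatMap : ∀ (G : A → List B) xs f → ∑ (concatMap G xs) f ≡ ∑[ x ∈ xs ] ∑ (G x) f
∑-concatMap G []       f = refl
∑-concatMap G (x ∷ xs) f =
  trans (∑-++ (G x) (concatMap G xs) f) (cong (∑ (G x) f +_) (∑-concatMap G xs f))

∑-cong : ∀ (xs : List A) {f g} → (∀ {x} → x ∈ xs → f x ≡ g x) → ∑ xs f ≡ ∑ xs g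
∑-cong []       eq = refl
∑-cong (x ∷ xs) eq = cong₂ _+_ (eq (here refl)) (∑-cong xs (eq ∘ there))

∑-zero : ∀ (xs : List A) {f} → (∀ {x} → x ∈ xs → f x ≡ 0) → ∑ xs f ≡ 0
∑-zero []       eq = refl
∑-zero (x ∷ xs) eq = cong₂ _+_ (eq (here refl)) (∑-zero xs (eq ∘ there))

∑-+ : ∀ (xs : List A) f g → ∑[ x ∈ xs ] (f x + g x) ≡ ∑ xs f + ∑ xs g
∑-+ []       f g = refl
∑-+ (x ∷ xs) f g = trans (cong (f x + g x +_) (∑-+ xs f g)) (+-+-comm (f x) (g x) _ _)
  where
  +-+-comm : ∀ p q r s → p + q + (r + s) ≡ p + r + (q + s)
  +-+-comm = solve-∀

∑-swap : ∀ (xs : List A) (ys : List B) (f : A → B → ℕ) →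
         ∑[ x ∈ xs ] ∑[ y ∈ ys ] f x y ≡ ∑[ y ∈ ys ] ∑[ x ∈ xs ] f x y
∑-swap []       ys f = sym (∑-zero ys (λ _ → refl))
∑-swap (x ∷ xs) ys f =
  trans (cong (∑ ys (f x) +_) (∑-swap xs ys f)) (sym (∑-+ ys (f x) (λ y → ∑[ x ∈ xs ] f x y)))

∑-↭ : ∀ {xs ys : List A} f → xs ↭ ys → ∑ xs f ≡ ∑ ys f
∑-↭ f p = sum-↭ (↭.map⁺ f p)

δ : ℕ → ℕ → ℕ
δ x y = if does (x ≟ y) then 1 else 0

δ-refl : ∀ x → δ x x ≡ 1
δ-refl x = cong (if_then 1 else 0) (dec-true (x ≟ x) refl)

δ-≢ : ∀ {x y} → x ≢ y → δ x y ≡ 0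
δ-≢ {x} {y} x≢y = cong (if_then 1 else 0) (dec-false (x ≟ y) x≢y)

δ-cong : ∀ {x y x′ y′} → (x ≡ y → x′ ≡ y′) → (x′ ≡ y′ → x ≡ y) → δ x y ≡ δ x′ y′
δ-cong {x} {y} {x′} to from with x ≟ y
... | yes refl = trans (δ-refl x) (sym (trans (cong (δ x′) (sym (to refl))) (δ-refl x′)))
... | no  x≢y  = trans (δ-≢ x≢y) (sym (δ-≢ (x≢y ∘ from)))

count-∑ : ∀ g xs → length (filter (_≟ g) xs) ≡ ∑[ x ∈ xs ] δ x g
count-∑ g []       = refl
count-∑ g (x ∷ xs) with does (x ≟ g)
... | true  = cong suc (count-∑ g xs)
... | false = count-∑ g xs

∑-upTo-suc : ∀ b f → ∑ (upTo (suc b)) f ≡ f 0 + ∑ (upTo b) (f ∘ suc)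
∑-upTo-suc b f = cong (f 0 +_) (trans (cong (λ xs → ∑ xs f) (sym (map-upTo suc b))) (∑-map suc (upTo b) f))

∑-upTo-δ : ∀ {b R} → R < b → ∑[ r ∈ upTo b ] δ r R ≡ 1
∑-upTo-δ {suc b} {zero}  _         =
  trans (∑-upTo-suc b (λ r → δ r 0)) (cong suc (∑-zero (upTo b) (λ _ → refl)))
∑-upTo-δ {suc b} {suc R} (s≤s R<b) = trans (∑-upTo-suc b (λ r → δ r (suc R))) (∑-upTo-δ R<b)

applyUpTo-downFrom : ∀ b → applyUpTo (λ s → b ∸ suc s) b ≡ downFrom b
applyUpTo-downFrom zero    = refl
applyUpTo-downFrom (suc b) = cong (b ∷_) (applyUpTo-downFrom b)

∑-upTo-reverse : ∀ b f → ∑[ s ∈ upTo b ] f (b ∸ suc s) ≡ ∑ (upTo b) f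
∑-upTo-reverse b f = begin
  ∑[ s ∈ upTo b ] f (b ∸ suc s)           ≡⟨ ∑-map (λ s → b ∸ suc s) (upTo b) f ⟨
  ∑ (map (λ s → b ∸ suc s) (upTo b)) f    ≡⟨ cong (λ xs → ∑ xs f) (map-upTo _ b) ⟩
  ∑ (applyUpTo (λ s → b ∸ suc s) b) f     ≡⟨ cong (λ xs → ∑ xs f) (applyUpTo-downFrom b) ⟩
  ∑ (downFrom b) f                        ≡⟨ cong (λ xs → ∑ xs f) (reverse-upTo b) ⟨
  ∑ (reverse (upTo b)) f                  ≡⟨ ∑-↭ f (↭.↭-reverse (upTo b)) ⟩
  ∑ (upTo b) f                            ∎

+-*-unique : ∀ {b r R i Q} → r < b → R < b → r + i * b ≡ R + Q * b → r ≡ R × i ≡ Q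
+-*-unique {b} {r} {R} {i} {Q} r<b R<b eq = r≡R , *-cancelʳ-≡ i Q b (+-cancelˡ-≡ r _ _ eq′)
  where
  instance
    b≢0 : NonZero b
    b≢0 = >-nonZero (≤-<-trans z≤n r<b)
  r≡R : r ≡ R
  r≡R = begin
    r               ≡⟨ m<n⇒m%n≡m r<b ⟨
    r % b           ≡⟨ [m+kn]%n≡m%n r i b ⟨
    (r + i * b) % b ≡⟨ cong (_% b) eq ⟩
    (R + Q * b) % b ≡⟨ [m+kn]%n≡m%n R Q b ⟩
    R % b           ≡⟨ m<n⇒m%n≡m R<b ⟩
    R               ∎
  eq′ : r + i * b ≡ r + Q * b
  eq′ = trans eq (cong (_+ Q * b) (sym r≡R))

∑-digit : ∀ {b R} i Q → R < b → ∑[ r ∈ upTo b ] δ (r + i * b) (R + Q * b) ≡ δ i Q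
∑-digit {b} {R} i Q R<b with i ≟ Q
... | yes refl = begin
  ∑[ r ∈ upTo b ] δ (r + i * b) (R + i * b) ≡⟨ ∑-cong (upTo b) (λ {r} _ → δ-cong (+-cancelʳ-≡ (i * b) r R) (cong (_+ i * b))) ⟩
  ∑[ r ∈ upTo b ] δ r R                     ≡⟨ ∑-upTo-δ R<b ⟩
  1                                         ≡⟨ δ-refl i ⟨
  δ i i                                     ∎
... | no i≢Q = trans (∑-zero (upTo b) (λ r∈ → δ-≢ (i≢Q ∘ proj₂ ∘ +-*-unique (∈-upTo⁻ r∈) R<b))) (sym (δ-≢ i≢Q))

block-count : ∀ {a R} j Q → R < a → ∑[ s ∈ upTo a ] δ (j * a ∸ s) (suc (R + Q * a)) ≡ δ j (suc Q)
block-count {a} {R} zero Q R<a = ∑-zero (upTo a) (λ {s} _ → cong (λ z → δ z (suc (R + Q * a))) (0∸n≡0 s))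
block-count {a} {R} (suc i) Q R<a = begin
  ∑[ s ∈ upTo a ] δ (suc i * a ∸ s) (suc (R + Q * a))
    ≡⟨ ∑-cong (upTo a) (λ s∈ → cong (λ z → δ z (suc (R + Q * a))) (suc-block (∈-upTo⁻ s∈))) ⟩
  ∑[ s ∈ upTo a ] δ (a ∸ suc s + i * a) (R + Q * a)
    ≡⟨ ∑-upTo-reverse a (λ r → δ (r + i * a) (R + Q * a)) ⟩
  ∑[ r ∈ upTo a ] δ (r + i * a) (R + Q * a)
    ≡⟨ ∑-digit i Q R<a ⟩
  δ i Q ∎
  where
  suc-block : ∀ {s} → s < a → suc i * a ∸ s ≡ suc (a ∸ suc s + i * a)
  suc-block s<a = trans (+-∸-comm (i * a) (<⇒≤ s<a)) (cong (_+ i * a) (+-∸-assoc 1 s<a))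

4*t+suc : ∀ t c → 4 * t + suc c ≡ suc (c + t * 4)
4*t+suc = solve-∀

δ-four-residues : ∀ {E} t t0 → E < 4 →
  let v = suc (E + t0 * 4) in
  δ (4 * t + 3) v + δ (4 * t + 1) v + (δ (4 * t + 4) v + δ (4 * t + 2) v + 0) ≡ δ t t0
δ-four-residues {E} t t0 E<4 =
  trans (cong₂ _+_ (cong₂ _+_ (digit 2) (digit 0)) (cong₂ _+_ (cong₂ _+_ (digit 3) (digit 1)) refl))
        (trans (reorder (d 0) (d 1) (d 2) (d 3)) (∑-digit t t0 E<4))
  where
  d : ℕ → ℕ
  d c = δ (c + t * 4) (E + t0 * 4)
  digit : ∀ c → δ (4 * t + suc c) (suc (E + t0 * 4)) ≡ d c
  digit c = cong (λ z → δ z (suc (E + t0 * 4))) (4*t+suc t c)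
  reorder : ∀ p q r s → r + p + (s + q + 0) ≡ p + (q + (r + (s + 0)))
  reorder = solve-∀

module _ (n : ℕ) .{{_ : NonZero n}} {x y : ℕ} where

  diffZ-≤ : x ≤ y → y < n → diffZ n y x ≡ y ∸ x
  diffZ-≤ x≤y y<n = begin
    (y + (n ∸ x % n)) % n ≡⟨ cong (λ z → (y + (n ∸ z)) % n) (m<n⇒m%n≡m (≤-<-trans x≤y y<n)) ⟩
    (y + (n ∸ x)) % n     ≡⟨ cong (_% n) (sym (+-∸-assoc y (<⇒≤ (≤-<-trans x≤y y<n)))) ⟩
    (y + n ∸ x) % n       ≡⟨ cong (_% n) (+-∸-comm n x≤y) ⟩
    (y ∸ x + n) % n       ≡⟨ [m+n]%n≡m%n (y ∸ x) n ⟩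
    (y ∸ x) % n           ≡⟨ m<n⇒m%n≡m (≤-<-trans (m∸n≤m y x) y<n) ⟩
    y ∸ x                 ∎

  diffZ-< : x < y → y < n → diffZ n x y ≡ n ∸ (y ∸ x)
  diffZ-< x<y y<n = begin
    (x + (n ∸ y % n)) % n   ≡⟨ cong (λ z → (x + (n ∸ z)) % n) (m<n⇒m%n≡m y<n) ⟩
    (x + (n ∸ y)) % n       ≡⟨ cong (_% n) (sym (+-∸-assoc x (<⇒≤ y<n))) ⟩
    (x + n ∸ y) % n         ≡⟨ cong (λ z → (x + n ∸ z) % n) (m+[n∸m]≡n (<⇒≤ x<y)) ⟨
    (x + n ∸ (x + (y ∸ x))) % n ≡⟨ cong (_% n) ([m+n]∸[m+o]≡n∸o x n (y ∸ x)) ⟩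
    (n ∸ (y ∸ x)) % n       ≡⟨ m<n⇒m%n≡m (∸-monoʳ-< (m<n⇒0<n∸m x<y) (≤-trans (m∸n≤m y x) (<⇒≤ y<n))) ⟩
    n ∸ (y ∸ x)             ∎

  δ-diffZ-swap : ∀ {g} → x < y → y < n → g ≤ n → δ (diffZ n x y) g ≡ δ (diffZ n y x) (n ∸ g)
  δ-diffZ-swap x<y y<n g≤n rewrite diffZ-< x<y y<n | diffZ-≤ (<⇒≤ x<y) y<n =
    δ-cong (λ e → trans (sym (m∸[m∸n]≡n y∸x≤n)) (cong (n ∸_) e))
           (λ e → trans (cong (n ∸_) e) (m∸[m∸n]≡n g≤n))
    where
    y∸x≤n : y ∸ x ≤ n
    y∸x≤n = ≤-trans (m∸n≤m y x) (<⇒≤ y<n)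

-- For a pair family, diffMultiset has a single other index, which leaves the trailing ++ [].
count-differences : ∀ g (h : ℕ → ℕ → ℕ) (X Y : List ℕ) →
  length (filter (_≟ g) (concatMap (λ y → map (h y) X ++ []) Y)) ≡ ∑[ y ∈ Y ] ∑[ x ∈ X ] δ (h y x) g
count-differences g h X Y = begin
  length (filter (_≟ g) (concatMap (λ y → map (h y) X ++ []) Y))
    ≡⟨ count-∑ g (concatMap (λ y → map (h y) X ++ []) Y) ⟩
  ∑ (concatMap (λ y → map (h y) X ++ []) Y) (λ z → δ z g)
    ≡⟨ ∑-concatMap _ Y _ ⟩
  ∑[ y ∈ Y ] ∑ (map (h y) X ++ []) (λ z → δ z g)
    ≡⟨ ∑-cong Y (λ {y} _ → trans (cong (λ xs → ∑ xs (λ z → δ z g)) (++-identityʳ (map (h y) X))) (∑-map (h y) X _)) ⟩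
  ∑[ y ∈ Y ] ∑[ x ∈ X ] δ (h y x) g ∎

pair-isSEDF : ∀ n .{{_ : NonZero n}} {k m} (X Y : List ℕ) →
  Unique X → Unique Y → length X ≡ k → length Y ≡ k →
  m ≤ n → All (_< m) X → All (λ y → m ≤ y × y < n) Y →
  (∀ {g} → 0 < g → g < n → ∑[ y ∈ Y ] ∑[ x ∈ X ] δ (diffZ n y x) g ≡ 1) →
  IsSEDF n 2 k 1 (pair X Y)
pair-isSEDF n X Y uX uY |X| |Y| m≤n X-below Y-between once =
  s≤s (s≤s z≤n) ,
  (λ { zero       → uX , |X| , All.map (λ x<m → <-≤-trans x<m m≤n) X-below
     ; (suc zero) → uY , |Y| , All.map proj₂ Y-between }) ,
  (λ { zero       zero       0≢0 → ⊥-elim (0≢0 refl)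
     ; zero       (suc zero) _   → X∩Y=∅
     ; (suc zero) zero       _   → λ (v∈Y , v∈X) → X∩Y=∅ (v∈X , v∈Y)
     ; (suc zero) (suc zero) 1≢1 → ⊥-elim (1≢1 refl) }) ,
  (λ { zero       g 0<g g<n → X−Y g 0<g g<n
     ; (suc zero) g 0<g g<n → trans (count-differences g (diffZ n) X Y) (once 0<g g<n) })
  where
  x<y : ∀ {x y} → x ∈ X → y ∈ Y → x < y
  x<y x∈ y∈ = <-≤-trans (All.lookup X-below x∈) (proj₁ (All.lookup Y-between y∈))
  X∩Y=∅ : Disjoint X Y
  X∩Y=∅ (v∈X , v∈Y) = <-irrefl refl (x<y v∈X v∈Y)
  X−Y : ∀ g → 0 < g → g < n → length (filter (_≟ g) (diffMultiset n (pair X Y) zero)) ≡ 1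
  X−Y g 0<g g<n = begin
    length (filter (_≟ g) (diffMultiset n (pair X Y) zero))
      ≡⟨ count-differences g (diffZ n) Y X ⟩
    ∑[ x ∈ X ] ∑[ y ∈ Y ] δ (diffZ n x y) g
      ≡⟨ ∑-swap X Y _ ⟩
    ∑[ y ∈ Y ] ∑[ x ∈ X ] δ (diffZ n x y) g
      ≡⟨ ∑-cong Y (λ y∈ → ∑-cong X (λ x∈ →
           δ-diffZ-swap n (x<y x∈ y∈) (proj₂ (All.lookup Y-between y∈)) (<⇒≤ g<n))) ⟩
    ∑[ y ∈ Y ] ∑[ x ∈ X ] δ (diffZ n y x) (n ∸ g)
      ≡⟨ once (m<n⇒0<n∸m g<n) (∸-monoʳ-< 0<g (<⇒≤ g<n)) ⟩
    1 ∎

module _ (a : ℕ) .{{_ : NonZero a}} where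

  private
    n : ℕ
    n = suc ((2 * a) * (2 * a))

  B2-block : ℕ → List ℕ
  B2-block t = (4 * t + 3) * a ∷ (4 * t + 4) * a ∷ []

  4a*a≡2a*2a : 4 * a * a ≡ 2 * a * (2 * a)
  4a*a≡2a*2a = identity a
    where
    identity : ∀ a → 4 * a * a ≡ 2 * a * (2 * a)
    identity = solve-∀

  *a<n : ∀ {j} → j ≤ 4 * a → j * a < n
  *a<n j≤4a = s≤s (≤-trans (*-monoˡ-≤ a j≤4a) (≤-reflexive 4a*a≡2a*2a))

  4t+c≤4a : ∀ {t c} → t < a → c ≤ 4 → 4 * t + c ≤ 4 * a
  4t+c≤4a {t} t<a c≤4 = ≤-trans (+-monoʳ-≤ (4 * t) c≤4)
    (≤-trans (≤-reflexive (trans (+-comm (4 * t) 4) (sym (*-suc 4 t)))) (*-monoʳ-≤ 4 t<a))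

  B1-below : All (_< 3 * a) (B1 a)
  B1-below = All.++⁺ (All.applyUpTo⁺₁ id a (λ s<a → <-≤-trans s<a (m≤m+n a (2 * a))))
                     (All.map⁺ (All.applyUpTo⁺₁ id a (λ s<a → 2a+s<3a s<a)))
    where
    2a+s<3a : ∀ {s} → s < a → 2 * a + s < 3 * a
    2a+s<3a s<a = <-≤-trans (+-monoʳ-< (2 * a) s<a) (≤-reflexive (+-comm (2 * a) a))

  B2-between : All (λ y → 3 * a ≤ y × y < n) (B2 a)
  B2-between = All.concat⁺ (All.map⁺ (All.applyUpTo⁺₁ id a (λ t<a →
    between t<a ≤-refl (n≤1+n 3) ∷ between t<a (n≤1+n 3) ≤-refl ∷ [])))
    where
    between : ∀ {t c} → t < a → 3 ≤ c → c ≤ 4 → 3 * a ≤ (4 * t + c) * a × (4 * t + c) * a < n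
    between {t} {c} t<a 3≤c c≤4 =
      *-monoˡ-≤ a (≤-trans 3≤c (m≤n+m c (4 * t))) ,
      *a<n (4t+c≤4a t<a c≤4)

  B2-block-index : ∀ {t y} → y ∈ B2-block t → ∃ λ c → c < 4 × y ≡ (4 * t + suc c) * a
  B2-block-index (here refl)         = 2 , n≤1+n 3 , refl
  B2-block-index (there (here refl)) = 3 , ≤-refl , refl

  B2-blocks-disjoint : ∀ {t t′} → t ≢ t′ → Disjoint (B2-block t) (B2-block t′)
  B2-blocks-disjoint {t} {t′} t≢t′ (y∈ , y∈′) with B2-block-index {t} y∈ | B2-block-index {t′} y∈′
  ... | c , c<4 , e | c′ , c′<4 , e′ = t≢t′ (proj₂ (+-*-unique c<4 c′<4 (suc-injective (begin
    suc (c + t * 4)   ≡⟨ 4*t+suc t c ⟨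
    4 * t + suc c     ≡⟨ *-cancelʳ-≡ _ _ a (trans (sym e) e′) ⟩
    4 * t′ + suc c′   ≡⟨ 4*t+suc t′ c′ ⟩
    suc (c′ + t′ * 4) ∎))))

  Unique-B1 : Unique (B1 a)
  Unique-B1 = Unique.++⁺ (Unique.upTo⁺ a) (Unique.map⁺ (+-cancelˡ-≡ (2 * a) _ _) (Unique.upTo⁺ a)) disjoint
    where
    disjoint : Disjoint (upTo a) (map (2 * a +_) (upTo a))
    disjoint (v∈ , v∈′) with ∈-map⁻ (2 * a +_) v∈′
    ... | s , _ , refl = <⇒≱ (∈-upTo⁻ v∈) (≤-trans (m≤m+n a (a + 0)) (m≤m+n (2 * a) s))

  Unique-B2 : Unique (B2 a)
  Unique-B2 = Unique.concat⁺ (All.map⁺ (All.applyUpTo⁺₁ id a (λ {t} _ → block-unique t)))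
                             (AllPairs.map⁺ (AllPairs.applyUpTo⁺₁ id a (λ i<j _ → B2-blocks-disjoint (<⇒≢ i<j))))
    where
    block-unique : ∀ t → Unique (B2-block t)
    block-unique t = ((3≢4 ∘ +-cancelˡ-≡ (4 * t) 3 4 ∘ *-cancelʳ-≡ _ _ a) ∷ []) ∷ [] ∷ []
      where
      3≢4 : 3 ≢ 4
      3≢4 ()

  length-B1 : length (B1 a) ≡ 2 * a
  length-B1 = begin
    length (upTo a ++ map (2 * a +_) (upTo a)) ≡⟨ length-++ (upTo a) ⟩
    length (upTo a) + length (map (2 * a +_) (upTo a)) ≡⟨ cong (length (upTo a) +_) (length-map _ (upTo a)) ⟩
    length (upTo a) + length (upTo a) ≡⟨ cong₂ _+_ (length-upTo a) (trans (length-upTo a) (sym (+-identityʳ a))) ⟩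
    2 * a ∎

  length-B2 : length (B2 a) ≡ 2 * a
  length-B2 = trans (two-per-block (upTo a)) (cong (2 *_) (length-upTo a))
    where
    two-per-block : ∀ ts → length (concatMap B2-block ts) ≡ 2 * length ts
    two-per-block []       = refl
    two-per-block (t ∷ ts) = trans (cong (2 +_) (two-per-block ts)) (sym (*-suc 2 (length ts)))

  B1-count : ∀ {R Q} j → R < a → 3 ≤ j → j * a < n →
    ∑[ x ∈ B1 a ] δ (diffZ n (j * a) x) (suc (R + Q * a)) ≡ δ j (suc Q) + δ (j ∸ 2) (suc Q)
  B1-count {R} {Q} j R<a 3≤j ja<n = begin
    ∑[ x ∈ B1 a ] F x
      ≡⟨ ∑-++ (upTo a) _ F ⟩
    ∑ (upTo a) F + ∑ (map (2 * a +_) (upTo a)) F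
      ≡⟨ cong (∑ (upTo a) F +_) (∑-map (2 * a +_) (upTo a) F) ⟩
    ∑ (upTo a) F + ∑[ s ∈ upTo a ] F (2 * a + s)
      ≡⟨ cong₂ _+_ (∑-cong (upTo a) (low ∘ ∈-upTo⁻)) (∑-cong (upTo a) (high ∘ ∈-upTo⁻)) ⟩
    ∑[ s ∈ upTo a ] δ (j * a ∸ s) g + ∑[ s ∈ upTo a ] δ ((j ∸ 2) * a ∸ s) g
      ≡⟨ cong₂ _+_ (block-count j Q R<a) (block-count (j ∸ 2) Q R<a) ⟩
    δ j (suc Q) + δ (j ∸ 2) (suc Q) ∎
    where
    g : ℕ
    g = suc (R + Q * a)
    F : ℕ → ℕ
    F x = δ (diffZ n (j * a) x) g
    2a+s≤ja : ∀ {s} → s < a → 2 * a + s ≤ j * a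
    2a+s≤ja {s} s<a = ≤-trans (≤-trans (+-monoʳ-≤ (2 * a) (<⇒≤ s<a)) (≤-reflexive (+-comm (2 * a) a))) (*-monoˡ-≤ a 3≤j)
    low : ∀ {s} → s < a → F s ≡ δ (j * a ∸ s) g
    low {s} s<a = cong (λ z → δ z g) (diffZ-≤ n (≤-trans (m≤n+m s (2 * a)) (2a+s≤ja s<a)) ja<n)
    high : ∀ {s} → s < a → F (2 * a + s) ≡ δ ((j ∸ 2) * a ∸ s) g
    high {s} s<a = cong (λ z → δ z g) (begin
      diffZ n (j * a) (2 * a + s) ≡⟨ diffZ-≤ n (2a+s≤ja s<a) ja<n ⟩
      j * a ∸ (2 * a + s)         ≡⟨ ∸-+-assoc (j * a) (2 * a) s ⟨
      j * a ∸ 2 * a ∸ s           ≡⟨ cong (_∸ s) (*-distribʳ-∸ a j 2) ⟨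
      (j ∸ 2) * a ∸ s             ∎)

  B2-block-count : ∀ {R E t0} t → R < a → t < a → E < 4 →
    ∑[ y ∈ B2-block t ] ∑[ x ∈ B1 a ] δ (diffZ n y x) (suc (R + (E + t0 * 4) * a)) ≡ δ t t0
  B2-block-count {R} {E} {t0} t R<a t<a E<4 =
    trans (cong₂ (λ p q → p + (q + 0)) (count-at 3 ≤-refl (n≤1+n 3)) (count-at 4 (n≤1+n 3) ≤-refl))
          (δ-four-residues t t0 E<4)
    where
    v : ℕ
    v = suc (E + t0 * 4)
    count-at : ∀ c → 3 ≤ c → c ≤ 4 →
      ∑[ x ∈ B1 a ] δ (diffZ n ((4 * t + c) * a) x) (suc (R + (E + t0 * 4) * a))
        ≡ δ (4 * t + c) v + δ (4 * t + (c ∸ 2)) v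
    count-at c 3≤c c≤4 =
      trans (B1-count (4 * t + c) R<a (≤-trans 3≤c (m≤n+m c (4 * t)))
                      (*a<n (4t+c≤4a t<a c≤4)))
            (cong (λ j → δ (4 * t + c) v + δ j v) (+-∸-assoc (4 * t) (≤-trans (n≤1+n 2) 3≤c)))

  B2-B1-count : ∀ {g} → 0 < g → g < n → ∑[ y ∈ B2 a ] ∑[ x ∈ B1 a ] δ (diffZ n y x) g ≡ 1
  B2-B1-count {suc g′} _ (s≤s g′<4a²) = begin
    ∑[ y ∈ B2 a ] F y (suc g′)
      ≡⟨ cong (λ h → ∑[ y ∈ B2 a ] F y (suc h)) g′≡ ⟩
    ∑[ y ∈ B2 a ] F y (suc (R + (E + t0 * 4) * a))
      ≡⟨ ∑-concatMap B2-block (upTo a) _ ⟩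
    ∑[ t ∈ upTo a ] ∑[ y ∈ B2-block t ] F y (suc (R + (E + t0 * 4) * a))
      ≡⟨ ∑-cong (upTo a) (λ {t} t∈ → B2-block-count t (m%n<n g′ a) (∈-upTo⁻ t∈) (m%n<n Q 4)) ⟩
    ∑[ t ∈ upTo a ] δ t t0
      ≡⟨ ∑-upTo-δ (m<n*o⇒m/o<n {Q} {a} {4} (subst (Q <_) (*-comm 4 a) Q<4a)) ⟩
    1 ∎
    where
    F : ℕ → ℕ → ℕ
    F y g = ∑[ x ∈ B1 a ] δ (diffZ n y x) g
    R Q E t0 : ℕ
    R = g′ % a
    Q = g′ / a
    E = Q % 4
    t0 = Q / 4
    g′≡ : g′ ≡ R + (E + t0 * 4) * a
    g′≡ = trans (m≡m%n+[m/n]*n g′ a) (cong (λ q → R + q * a) (m≡m%n+[m/n]*n Q 4))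
    Q<4a : Q < 4 * a
    Q<4a = m<n*o⇒m/o<n {g′} {4 * a} {a} (subst (g′ <_) (sym 4a*a≡2a*2a) g′<4a²)

  B-isSEDF : IsSEDF n 2 (2 * a) 1 (pair (B1 a) (B2 a))
  B-isSEDF = pair-isSEDF n (B1 a) (B2 a) Unique-B1 Unique-B2 length-B1 length-B2
                         (<⇒≤ (*a<n (≤-trans (n≤1+n 3) (m≤m*n 4 a)))) B1-below B2-between B2-B1-count

module Congruence (m : ℕ) where

  n : ℕ
  n = suc m

  infix 4 _≡ₙ_
  record _≡ₙ_ (x y : ℕ) : Set where
    constructor mod-eq
    field %-eq : x % n ≡ y % n
  open _≡ₙ_

  ≡⇒≡ₙ : ∀ {x y} → x ≡ y → x ≡ₙ y
  ≡⇒≡ₙ eq = mod-eq (cong (_% n) eq)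

  ≡ₙ-sym : ∀ {x y} → x ≡ₙ y → y ≡ₙ x
  ≡ₙ-sym (mod-eq eq) = mod-eq (sym eq)

  ≡ₙ-trans : ∀ {x y z} → x ≡ₙ y → y ≡ₙ z → x ≡ₙ z
  ≡ₙ-trans (mod-eq eq) (mod-eq eq′) = mod-eq (trans eq eq′)

  %-≡ₙ : ∀ x → x % n ≡ₙ x
  %-≡ₙ x = mod-eq (m%n%n≡m%n x n)

  +-≡ₙ : ∀ {x x′ y y′} → x ≡ₙ x′ → y ≡ₙ y′ → x + y ≡ₙ x′ + y′
  +-≡ₙ {x} {x′} {y} {y′} (mod-eq x≡) (mod-eq y≡) = mod-eq (begin
    (x + y) % n                ≡⟨ %-distribˡ-+ x y n ⟩
    (x % n + y % n) % n        ≡⟨ cong₂ (λ p q → (p + q) % n) x≡ y≡ ⟩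
    (x′ % n + y′ % n) % n      ≡⟨ %-distribˡ-+ x′ y′ n ⟨
    (x′ + y′) % n              ∎)

  *-≡ₙ : ∀ {x x′ y y′} → x ≡ₙ x′ → y ≡ₙ y′ → x * y ≡ₙ x′ * y′
  *-≡ₙ {x} {x′} {y} {y′} (mod-eq x≡) (mod-eq y≡) = mod-eq (begin
    (x * y) % n                ≡⟨ %-distribˡ-* x y n ⟩
    (x % n * (y % n)) % n      ≡⟨ cong₂ (λ p q → (p * q) % n) x≡ y≡ ⟩
    (x′ % n * (y′ % n)) % n    ≡⟨ %-distribˡ-* x′ y′ n ⟨
    (x′ * y′) % n              ∎)

  ≡ₙ⇒≡ : ∀ {x y} → x < n → y < n → x ≡ₙ y → x ≡ y
  ≡ₙ⇒≡ x<n y<n (mod-eq eq) = trans (sym (m<n⇒m%n≡m x<n)) (trans eq (m<n⇒m%n≡m y<n))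

  +-*n-≡ₙ : ∀ x z → x + z * n ≡ₙ x
  +-*n-≡ₙ x z = mod-eq ([m+kn]%n≡m%n x z n)

  +-cancelʳ-≡ₙ : ∀ {x y} z → x + z ≡ₙ y + z → x ≡ₙ y
  +-cancelʳ-≡ₙ {x} {y} z eq =
    ≡ₙ-trans (≡ₙ-sym (absorb x)) (≡ₙ-trans (+-≡ₙ eq (≡⇒≡ₙ {z * m} refl)) (absorb y))
    where
    absorb : ∀ x → x + z + z * m ≡ₙ x
    absorb x = ≡ₙ-trans (≡⇒≡ₙ (trans (+-assoc x z (z * m)) (cong (x +_) (sym (*-suc z m))))) (+-*n-≡ₙ x z)

  ≡ₙ0⇒¬IsUnit : ∀ {u} → 1 < n → u ≡ₙ 0 → ¬ IsUnit n u
  ≡ₙ0⇒¬IsUnit {u} 1<n u≡0 (v , uv≡1) = 0≢1+n (begin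
    0           ≡⟨⟩
    0 * v % n   ≡⟨ %-eq (*-≡ₙ u≡0 (≡⇒≡ₙ {v} refl)) ⟨
    u * v % n   ≡⟨ uv≡1 ⟩
    1 % n       ≡⟨ m<n⇒m%n≡m 1<n ⟩
    1           ∎)

  module Affine (u c : ℕ) where

    f : ℕ → ℕ
    f x = (u * x + c) % n

    -- f k − f 0 ≡ k (f 1 − f 0), with both sides moved so that no subtraction occurs.
    affine-gap : ∀ k → k * f 1 + f 0 ≡ₙ f k + k * f 0
    affine-gap k =
      ≡ₙ-trans (+-≡ₙ (*-≡ₙ (≡⇒≡ₙ {k} refl) (%-≡ₙ _)) (%-≡ₙ _))
      (≡ₙ-trans (≡⇒≡ₙ (regroup k u c))
                (≡ₙ-sym (+-≡ₙ (%-≡ₙ _) (*-≡ₙ (≡⇒≡ₙ {k} refl) (%-≡ₙ _)))))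
      where
      regroup : ∀ k u c → k * (u * 1 + c) + (u * 0 + c) ≡ (u * k + c) + k * (u * 0 + c)
      regroup = solve-∀

    f1≡f0⇒u≡ₙ0 : f 1 ≡ f 0 → u ≡ₙ 0
    f1≡f0⇒u≡ₙ0 eq = +-cancelʳ-≡ₙ c (mod-eq (begin
      (u + c) % n       ≡⟨ cong (λ x → (x + c) % n) (*-identityʳ u) ⟨
      (u * 1 + c) % n   ≡⟨ eq ⟩
      (u * 0 + c) % n   ≡⟨ cong (λ x → (x + c) % n) (*-zeroʳ u) ⟩
      c % n             ∎))

module _ (k : ℕ) where
  open Congruence (k * k)

  -- k · k ≡ −1, so x + y + k (k y) ≡ x and x + y + k (k x) ≡ y.
  *-cancelˡ-≡ₙ : ∀ {x y} → k * x ≡ₙ k * y → x ≡ₙ y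
  *-cancelˡ-≡ₙ {x} {y} eq =
    ≡ₙ-trans (≡ₙ-sym (absorb x y))
    (≡ₙ-trans (+-≡ₙ (≡⇒≡ₙ {x + y} refl) (*-≡ₙ (≡⇒≡ₙ {k} refl) (≡ₙ-sym eq)))
    (≡ₙ-trans (≡⇒≡ₙ (cong (_+ k * (k * x)) (+-comm x y))) (absorb y x)))
    where
    expand : ∀ k x y → x + y + k * (k * y) ≡ x + y * suc (k * k)
    expand = solve-∀
    absorb : ∀ x y → x + y + k * (k * y) ≡ₙ x
    absorb x y = ≡ₙ-trans (≡⇒≡ₙ (expand k x y)) (+-*n-≡ₙ x y)

  digit-pair< : ∀ {c d} → c < k → d < k → k * d + c < n
  digit-pair< {c} {d} c<k d<k = s≤s (<⇒≤ (<-≤-trans (+-monoʳ-< (k * d) c<k)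
    (≤-trans (≤-reflexive (trans (+-comm (k * d) k) (sym (*-suc k d)))) (*-monoʳ-≤ k d<k))))

  digits-gap : ∀ {c d e} → c < k → d < k → e < k → k * d + c ≡ₙ e + k * c → d ≡ c
  digits-gap {c} {d} {e} c<k d<k e<k eq = proj₂ (+-*-unique c<k e<k (begin
    c + d * k ≡⟨ trans (+-comm c (d * k)) (cong (_+ c) (*-comm d k)) ⟩
    k * d + c ≡⟨ ≡ₙ⇒≡ (digit-pair< c<k d<k) (subst (_< n) (+-comm (k * c) e) (digit-pair< e<k c<k)) eq ⟩
    e + k * c ≡⟨ cong (e +_) (*-comm k c) ⟩
    e + c * k ∎))

  -- Writing x = (p + 1) k etc., cancelling the unit k and then k + 1 turns the congruence into
  -- the one of digits-gap for p, q, r.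
  A2-gap : ∀ {x y z} → x ∈ A2 k → y ∈ A2 k → z ∈ A2 k → k * y + x ≡ₙ z + k * x → y ≡ x
  A2-gap x∈ y∈ z∈ eq with ∈-map⁻ (λ t → suc t * k) x∈ | ∈-map⁻ (λ t → suc t * k) y∈ | ∈-map⁻ (λ t → suc t * k) z∈
  ... | p , p∈ , refl | q , q∈ , refl | r , r∈ , refl =
    cong (λ t → suc t * k) (digits-gap (∈-upTo⁻ p∈) (∈-upTo⁻ q∈) (∈-upTo⁻ r∈)
      (+-cancelʳ-≡ₙ (suc k) (*-cancelˡ-≡ₙ
        (≡ₙ-trans (≡⇒≡ₙ (factorˡ k p q)) (≡ₙ-trans eq (≡⇒≡ₙ (factorʳ k p r)))))))
    where
    factorˡ : ∀ k p q → k * (k * q + p + suc k) ≡ k * (suc q * k) + suc p * k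
    factorˡ = solve-∀
    factorʳ : ∀ k p r → suc r * k + k * (suc p * k) ≡ k * (r + k * p + suc k)
    factorʳ = solve-∀

B≁A : ∀ a → 1 < a →
  ¬ Equivalent (suc ((2 * a) * (2 * a))) 2 (pair (B1 a) (B2 a)) (pair (A1 (2 * a)) (A2 (2 * a)))
B≁A a 1<a (u , c , _ , _ , u-unit , σ , same) =
  ≡ₙ0⇒¬IsUnit 1<n (f1≡f0⇒u≡ₙ0 (gap-trivial (σ ⟨$⟩ʳ zero) image)) u-unit
  where
  k : ℕ
  k = 2 * a
  open Congruence (k * k)
  open Affine u c
  1≤k : 1 ≤ k
  1≤k = ≤-trans (<⇒≤ 1<a) (m≤m+n a (a + 0))
  1<n : 1 < n
  1<n = s≤s (*-mono-≤ 1≤k 1≤k)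
  0∈B1 : 0 ∈ B1 a
  0∈B1 = ∈-++⁺ˡ (∈-upTo⁺ (<-trans z<s 1<a))
  1∈B1 : 1 ∈ B1 a
  1∈B1 = ∈-++⁺ˡ (∈-upTo⁺ 1<a)
  k∈B1 : k ∈ B1 a
  k∈B1 = subst (_∈ B1 a) (+-identityʳ k) (∈-++⁺ʳ (upTo a) (∈-map⁺ (k +_) (∈-upTo⁺ (<-trans z<s 1<a))))
  image : ∀ {x} → x ∈ B1 a → f x ∈ pair (A1 k) (A2 k) (σ ⟨$⟩ʳ zero)
  image {x} x∈ = Equivalence.from (same zero (f x)) (∈-map⁺ f x∈)
  gap-trivial : ∀ j → (∀ {x} → x ∈ B1 a → f x ∈ pair (A1 k) (A2 k) j) → f 1 ≡ f 0
  gap-trivial zero       img = digits-gap k (∈-upTo⁻ (img 0∈B1)) (∈-upTo⁻ (img 1∈B1)) (∈-upTo⁻ (img k∈B1)) (affine-gap k)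
  gap-trivial (suc zero) img = A2-gap k (img 0∈B1) (img 1∈B1) (img k∈B1) (affine-gap k)

theorem5p1 : (a : ℕ) → 1 ≤ a →
    IsSEDF (suc ((2 * a) * (2 * a))) 2 (2 * a) 1 (pair (B1 a) (B2 a))
    × (2 < 2 * a →
        ¬ Equivalent (suc ((2 * a) * (2 * a))) 2 (pair (B1 a) (B2 a)) (pair (A1 (2 * a)) (A2 (2 * a))))
theorem5p1 a 1≤a = B-isSEDF a , B≁A a ∘ *-cancelˡ-< 2 1 a
  where
  instance
    a≢0 : NonZero a
    a≢0 = >-nonZero 1≤a
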